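{- Let $K$ be an imaginary quadratic number field with ring of integers $\mathcal{O}_K$. Let $\{a,b,c,d\}\subseteq\mathcal{O}_K$ be a Diophantine quadruple with $2\leqslant|a|\leqslant|b|\leqslant|c|\leqslant|d|$. Then at least one of the triples $\{a,b,c\}$ and $\{a,b,d\}$ is not regular; that is, for $r\in\mathcal{O}_K$ with $r^2=ab+1$, it is impossible that $c=a+b-2r$ and $d=a+b+2r$ (or vice versa).
   Context: A Diophantine quadruple (resp. triple) in $\mathcal{O}_K$ is a set of four (resp. three) distinct elements of $\mathcal{O}_K$ such that the product of any two distinct elements plus one is a perfect square in $\mathcal{O}_K$. A Diophantine triple $\{a,b,c\}$ is called regular if $c=a+b\pm 2r$, where $r^2=ab+1$. -}

module Defs where

open import Data.Nat as ℕ using (ℕ)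
open import Data.Nat.DivMod as NDM using ()
open import Data.Nat.Divisibility as ND using ()
open import Data.Integer using (ℤ; +_; _+_; _-_; _*_; -_; _≤_)
open import Data.Product using (_×_; _,_; Σ; ∃; ∃-syntax)
open import Data.Sum using (_⊎_)
open import Relation.Binary.PropositionalEquality using (_≡_; _≢_)
open import Relation.Nullary using (¬_; yes; no)

SquareFree : ℕ → Set
SquareFree m = ∀ (k : ℕ) → (k ℕ.* k) ND.∣ m → k ≡ 1

-- The ring of integers of K = ℚ(√-m) (m ≥ 1 squarefree) is ℤ[ω], where
--   ω = (1 + √-m)/2  if  -m ≡ 1 (mod 4), i.e. m ≡ 3 (mod 4),  with  ω² = ω - (m+1)/4,
--   ω = √-m          otherwise,                                 with  ω² = -m.
-- In both cases ω² = tr·ω - nm with (tr , nm) given below.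
trω : ℕ → ℤ
trω m with m NDM.% 4 ℕ.≟ 3
... | yes _ = + 1
... | no  _ = + 0

nmω : ℕ → ℤ
nmω m with m NDM.% 4 ℕ.≟ 3
... | yes _ = + ((m ℕ.+ 1) NDM./ 4)
... | no  _ = + m

module OK (m : ℕ) where

  record 𝒪 : Set where
    constructor _+_ω
    field
      re : ℤ
      im : ℤ

  open 𝒪 public

  _⊕_ : 𝒪 → 𝒪 → 𝒪
  (x + y ω) ⊕ (u + v ω) = (x + u) + (y + v) ω

  _⊖_ : 𝒪 → 𝒪 → 𝒪
  (x + y ω) ⊖ (u + v ω) = (x - u) + (y - v) ω

  -- (x + yω)(u + vω) = xu + (xv + yu)ω + yv ω²,  ω² = tr ω - nm
  _⊗_ : 𝒪 → 𝒪 → 𝒪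
  (x + y ω) ⊗ (u + v ω) =
    (x * u - nmω m * (y * v)) + (x * v + y * u + trω m * (y * v)) ω

  𝟙 : 𝒪
  𝟙 = (+ 1) + (+ 0) ω

  𝟚 : 𝒪
  𝟚 = (+ 2) + (+ 0) ω

  -- Norm N(α) = |α|² (α viewed in ℂ): N(x + yω) = x² + tr·xy + nm·y².
  -- Hence |α| ≤ |β| ⟺ N α ≤ N β and 2 ≤ |α| ⟺ 4 ≤ N α.
  N : 𝒪 → ℤ
  N (x + y ω) = x * x + trω m * (x * y) + nmω m * (y * y)

  _≤∣∣_ : 𝒪 → 𝒪 → Set
  α ≤∣∣ β = N α ≤ N β

  IsSquare : 𝒪 → Set
  IsSquare α = ∃[ s ] (s ⊗ s ≡ α)

  DiophantineQuadruple : 𝒪 → 𝒪 → 𝒪 → 𝒪 → Set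
  DiophantineQuadruple a b c d =
    (a ≢ b × a ≢ c × a ≢ d × b ≢ c × b ≢ d × c ≢ d) ×
    (IsSquare ((a ⊗ b) ⊕ 𝟙) × IsSquare ((a ⊗ c) ⊕ 𝟙) × IsSquare ((a ⊗ d) ⊕ 𝟙) ×
     IsSquare ((b ⊗ c) ⊕ 𝟙) × IsSquare ((b ⊗ d) ⊕ 𝟙) × IsSquare ((c ⊗ d) ⊕ 𝟙))

  Regular : 𝒪 → 𝒪 → 𝒪 → Set
  Regular a b c = ∃[ r ] ((r ⊗ r ≡ (a ⊗ b) ⊕ 𝟙) ×
    ((c ≡ (a ⊕ b) ⊕ (𝟚 ⊗ r)) ⊎ (c ≡ (a ⊕ b) ⊖ (𝟚 ⊗ r))))

{-# OPTIONS --safe #-}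
-- If both triples are regular, r is determined up to sign, so the distinct elements c, d are
-- a + b + 2r and a + b - 2r: hence cd = (a - b)² - 4 and c + d = 2(a + b).  With t = a - b,
-- cd + 1 = s² reads (t - s)(t + s) = 3, and comparing the norms of the two factors gives
-- |2t| ≤ 4, so |t| ≤ 2 and |cd| = |t² - 4| ≤ 8.  On the other hand the parallelogram law gives
-- |c|² + |d|² ≥ |c + d|²/2 = 2|a + b|² = 2(2|a|² + 2|b|² - |t|²) ≥ 24, which together with
-- |c|, |d| ≥ 2 forces |cd|² ≥ 4(|c|² + |d|²) - 16 ≥ 80 > 64.  All norm estimates come from
-- the Cauchy–Schwarz inequality for the positive definite form N, squared to stay in ℤ.
module Submission where

open import Data.Nat using (ℕ)
open import Defs

module IntegerLemmas where
  open import Data.Nat as ℕ using (z≤n; s≤s)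
  import Data.Nat.Properties as ℕₚ
  open import Data.Integer using (ℤ; +_; -_; _+_; _-_; _*_; _≤_; 0ℤ; +≤+; -[1+_])
  import Data.Integer as ℤ using (_≤?_)
  import Data.Integer.Properties as ℤ
  open import Data.Integer.Tactic.RingSolver using (solve-∀)
  open import Data.Sum using (inj₁; inj₂)
  open import Relation.Nullary using (yes; no; contradiction)
  open import Relation.Binary.PropositionalEquality

  0≤i*i : ∀ i → 0ℤ ≤ i * i
  0≤i*i (+ n)    = subst (0ℤ ≤_) (ℤ.pos-* n n) (+≤+ z≤n)
  0≤i*i -[1+ n ] = +≤+ z≤n

  0≤i*j : ∀ {i j} → 0ℤ ≤ i → 0ℤ ≤ j → 0ℤ ≤ i * j
  0≤i*j {+ n} {+ k} _ _ = subst (0ℤ ≤_) (ℤ.pos-* n k) (+≤+ z≤n)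

  i*i≡0⇒i≡0 : ∀ i → i * i ≡ 0ℤ → i ≡ 0ℤ
  i*i≡0⇒i≡0 i eq with ℤ.i*j≡0⇒i≡0∨j≡0 i eq
  ... | inj₁ i≡0 = i≡0
  ... | inj₂ i≡0 = i≡0

  0≤i⇒0≤j⇒i+j≡0⇒j≡0 : ∀ {i j} → 0ℤ ≤ i → 0ℤ ≤ j → i + j ≡ 0ℤ → j ≡ 0ℤ
  0≤i⇒0≤j⇒i+j≡0⇒j≡0 {+ n} {+ k} _ _ eq = cong +_ (ℕₚ.m+n≡0⇒n≡0 n (ℤ.+-injective eq))

  1≤i⇒i*j≡0⇒j≡0 : ∀ {i j} → + 1 ≤ i → i * j ≡ 0ℤ → j ≡ 0ℤ
  1≤i⇒i*j≡0⇒j≡0 {i} 1≤i ij≡0 with ℤ.i*j≡0⇒i≡0∨j≡0 i ij≡0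
  ... | inj₁ refl = contradiction 1≤i λ { (+≤+ ()) }
  ... | inj₂ j≡0  = j≡0

  0≤i⇒i≢0⇒1≤i : ∀ {i} → 0ℤ ≤ i → i ≢ 0ℤ → + 1 ≤ i
  0≤i⇒i≢0⇒1≤i {+ 0}     _ i≢0 = contradiction refl i≢0
  0≤i⇒i≢0⇒1≤i {+ ℕ.suc n} _ _ = +≤+ (s≤s z≤n)

  i≤j⇒i*i≤j*j : ∀ {i j} → 0ℤ ≤ i → i ≤ j → i * i ≤ j * j
  i≤j⇒i*i≤j*j {i} {j} 0≤i i≤j = begin
    i * i ≤⟨ ℤ.*-monoˡ-≤-nonNeg i {{ℤ.nonNegative 0≤i}} i≤j ⟩
    i * j ≤⟨ ℤ.*-monoʳ-≤-nonNeg j {{ℤ.nonNegative (ℤ.≤-trans 0≤i i≤j)}} i≤j ⟩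
    j * j ∎
    where open ℤ.≤-Reasoning

  i*i≤j*j⇒i≤j : ∀ {i j} → 0ℤ ≤ j → i * i ≤ j * j → i ≤ j
  i*i≤j*j⇒i≤j {i} {j} 0≤j i²≤j² with i ℤ.≤? j
  ... | yes i≤j = i≤j
  ... | no  i≰j = contradiction i²≤j² (ℤ.<⇒≱ j*j<i*i)
    where
    open ℤ.≤-Reasoning
    j<i : j ℤ.< i
    j<i = ℤ.≰⇒> i≰j
    j*j<i*i : j * j ℤ.< i * i
    j*j<i*i = begin-strict
      j * j ≤⟨ ℤ.*-monoˡ-≤-nonNeg j {{ℤ.nonNegative 0≤j}} (ℤ.<⇒≤ j<i) ⟩
      j * i <⟨ ℤ.*-monoʳ-<-pos i {{ℤ.positive (ℤ.≤-<-trans 0≤j j<i)}} j<i ⟩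
      i * i ∎

  1≤i⇒j≤1⇒1≤4*i-j : ∀ {i j} → + 1 ≤ i → j ≤ + 1 → + 1 ≤ + 4 * i - j
  1≤i⇒j≤1⇒1≤4*i-j {i} {j} 1≤i j≤1 = begin
    + 1             ≤⟨ +≤+ (s≤s z≤n) ⟩
    + 4 * + 1 - + 1 ≤⟨ ℤ.+-mono-≤ (ℤ.*-monoˡ-≤-nonNeg (+ 4) 1≤i) (ℤ.neg-mono-≤ j≤1) ⟩
    + 4 * i - j     ∎
    where open ℤ.≤-Reasoning

  a≤i⇒a≤j⇒a*[i+j]≤i*j+a*a : ∀ {a i j} → a ≤ i → a ≤ j → a * (i + j) ≤ i * j + a * a
  a≤i⇒a≤j⇒a*[i+j]≤i*j+a*a {a} {i} {j} a≤i a≤j =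
    ℤ.0≤i-j⇒j≤i (subst (0ℤ ≤_) (expand a i j) (0≤i*j (ℤ.i≤j⇒0≤j-i a≤i) (ℤ.i≤j⇒0≤j-i a≤j)))
    where
    expand : ∀ a i j → (i - a) * (j - a) ≡ (i * j + a * a) - a * (i + j)
    expand = solve-∀

module QuadraticOrder (m : ℕ) where
  open import Data.Product using (_×_; _,_)
  open import Data.Nat as ℕ using (z≤n; NonZero)
  import Data.Nat.DivMod as ℕ
  import Data.Nat.Properties as ℕₚ
  open import Data.Integer using (ℤ; +_; -_; _+_; _-_; _*_; _≤_; 0ℤ; +≤+)
  import Data.Integer as ℤ using (_≟_)
  import Data.Integer.Properties as ℤ
  open import Data.Integer.Tactic.RingSolver using (solve-∀)
  open import Data.Maybe using (Maybe; just; nothing)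
  open import Data.Sum using (_⊎_; inj₁; inj₂)
  import Data.Sum as Sum
  open import Relation.Nullary using (yes; no; contradiction)
  open import Relation.Binary.PropositionalEquality
  open import Algebra.Bundles using (CommutativeRing)
  open import Algebra.Consequences.Propositional
    using (comm∧idˡ⇒idʳ; comm∧invˡ⇒invʳ; comm∧distrˡ⇒distrʳ)
  open import Algebra.Solver.Ring.AlmostCommutativeRing
    using (_-Raw-AlmostCommutative⟶_; fromCommutativeRing)
  import Algebra.Solver.Ring
  open IntegerLemmas
  open OK m
  open import Algebra.Definitions {A = 𝒪} _≡_

  ⊝_ : 𝒪 → 𝒪
  ⊝ (x + y ω) = (- x) + (- y) ω

  𝟘 : 𝒪
  𝟘 = (+ 0) + (+ 0) ω

  ι : ℤ → 𝒪
  ι i = i + (+ 0) ω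

  ⊕-assoc : Associative _⊕_
  ⊕-assoc (x₁ + x₂ ω) (y₁ + y₂ ω) (z₁ + z₂ ω) = cong₂ _+_ω (ℤ.+-assoc x₁ y₁ z₁) (ℤ.+-assoc x₂ y₂ z₂)

  ⊕-comm : Commutative _⊕_
  ⊕-comm (x₁ + x₂ ω) (y₁ + y₂ ω) = cong₂ _+_ω (ℤ.+-comm x₁ y₁) (ℤ.+-comm x₂ y₂)

  ⊕-identityˡ : LeftIdentity 𝟘 _⊕_
  ⊕-identityˡ (x₁ + x₂ ω) = cong₂ _+_ω (ℤ.+-identityˡ x₁) (ℤ.+-identityˡ x₂)

  ⊝-inverseˡ : LeftInverse 𝟘 ⊝_ _⊕_
  ⊝-inverseˡ (x₁ + x₂ ω) = cong₂ _+_ω (ℤ.+-inverseˡ x₁) (ℤ.+-inverseˡ x₂)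

  ⊗-assoc : Associative _⊗_
  ⊗-assoc (x₁ + x₂ ω) (y₁ + y₂ ω) (z₁ + z₂ ω) =
    cong₂ _+_ω (re-assoc (trω m) (nmω m) x₁ x₂ y₁ y₂ z₁ z₂) (im-assoc (trω m) (nmω m) x₁ x₂ y₁ y₂ z₁ z₂)
    where
    re-assoc : ∀ T M x₁ x₂ y₁ y₂ z₁ z₂ →
      (x₁ * y₁ - M * (x₂ * y₂)) * z₁ - M * ((x₁ * y₂ + x₂ * y₁ + T * (x₂ * y₂)) * z₂)
      ≡ x₁ * (y₁ * z₁ - M * (y₂ * z₂)) - M * (x₂ * (y₁ * z₂ + y₂ * z₁ + T * (y₂ * z₂)))
    re-assoc = solve-∀
    im-assoc : ∀ T M x₁ x₂ y₁ y₂ z₁ z₂ →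
      (x₁ * y₁ - M * (x₂ * y₂)) * z₂ + (x₁ * y₂ + x₂ * y₁ + T * (x₂ * y₂)) * z₁
        + T * ((x₁ * y₂ + x₂ * y₁ + T * (x₂ * y₂)) * z₂)
      ≡ x₁ * (y₁ * z₂ + y₂ * z₁ + T * (y₂ * z₂)) + x₂ * (y₁ * z₁ - M * (y₂ * z₂))
        + T * (x₂ * (y₁ * z₂ + y₂ * z₁ + T * (y₂ * z₂)))
    im-assoc = solve-∀

  ⊗-comm : Commutative _⊗_
  ⊗-comm (x₁ + x₂ ω) (y₁ + y₂ ω) = cong₂ _+_ω (re-comm (nmω m) x₁ x₂ y₁ y₂) (im-comm (trω m) x₁ x₂ y₁ y₂)
    where
    re-comm : ∀ M x₁ x₂ y₁ y₂ → x₁ * y₁ - M * (x₂ * y₂) ≡ y₁ * x₁ - M * (y₂ * x₂)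
    re-comm = solve-∀
    im-comm : ∀ T x₁ x₂ y₁ y₂ → x₁ * y₂ + x₂ * y₁ + T * (x₂ * y₂) ≡ y₁ * x₂ + y₂ * x₁ + T * (y₂ * x₂)
    im-comm = solve-∀

  ⊗-identityˡ : LeftIdentity 𝟙 _⊗_
  ⊗-identityˡ (x₁ + x₂ ω) = cong₂ _+_ω (re-identity (nmω m) x₁ x₂) (im-identity (trω m) x₁ x₂)
    where
    re-identity : ∀ M x₁ x₂ → + 1 * x₁ - M * (+ 0 * x₂) ≡ x₁
    re-identity = solve-∀
    im-identity : ∀ T x₁ x₂ → + 1 * x₂ + + 0 * x₁ + T * (+ 0 * x₂) ≡ x₂
    im-identity = solve-∀

  ⊗-distribˡ-⊕ : _⊗_ DistributesOverˡ _⊕_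
  ⊗-distribˡ-⊕ (x₁ + x₂ ω) (y₁ + y₂ ω) (z₁ + z₂ ω) =
    cong₂ _+_ω (re-distrib (nmω m) x₁ x₂ y₁ y₂ z₁ z₂) (im-distrib (trω m) x₁ x₂ y₁ y₂ z₁ z₂)
    where
    re-distrib : ∀ M x₁ x₂ y₁ y₂ z₁ z₂ →
      x₁ * (y₁ + z₁) - M * (x₂ * (y₂ + z₂)) ≡ (x₁ * y₁ - M * (x₂ * y₂)) + (x₁ * z₁ - M * (x₂ * z₂))
    re-distrib = solve-∀
    im-distrib : ∀ T x₁ x₂ y₁ y₂ z₁ z₂ →
      x₁ * (y₂ + z₂) + x₂ * (y₁ + z₁) + T * (x₂ * (y₂ + z₂))
      ≡ (x₁ * y₂ + x₂ * y₁ + T * (x₂ * y₂)) + (x₁ * z₂ + x₂ * z₁ + T * (x₂ * z₂))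
    im-distrib = solve-∀

  ι-⊗ : ∀ i j → ι (i * j) ≡ ι i ⊗ ι j
  ι-⊗ i j = cong₂ _+_ω (re-ι (nmω m) i j) (im-ι (trω m) i j)
    where
    re-ι : ∀ M i j → i * j ≡ i * j - M * (+ 0 * + 0)
    re-ι = solve-∀
    im-ι : ∀ T i j → + 0 ≡ i * + 0 + + 0 * j + T * (+ 0 * + 0)
    im-ι = solve-∀

  ⊕-⊗-commutativeRing : CommutativeRing _ _
  ⊕-⊗-commutativeRing = record
    { Carrier = 𝒪
    ; _≈_ = _≡_
    ; _+_ = _⊕_
    ; _*_ = _⊗_
    ; -_ = ⊝_
    ; 0# = 𝟘
    ; 1# = 𝟙
    ; isCommutativeRing = record
      { isRing = record
        { +-isAbelianGroup = record
          { isGroup = record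
            { isMonoid = record
              { isSemigroup = record
                { isMagma = record { isEquivalence = isEquivalence ; ∙-cong = cong₂ _⊕_ }
                ; assoc = ⊕-assoc
                }
              ; identity = ⊕-identityˡ , comm∧idˡ⇒idʳ ⊕-comm ⊕-identityˡ
              }
            ; inverse = ⊝-inverseˡ , comm∧invˡ⇒invʳ ⊕-comm ⊝-inverseˡ
            ; ⁻¹-cong = cong ⊝_
            }
          ; comm = ⊕-comm
          }
        ; *-cong = cong₂ _⊗_
        ; *-assoc = ⊗-assoc
        ; *-identity = ⊗-identityˡ , comm∧idˡ⇒idʳ ⊗-comm ⊗-identityˡ
        ; distrib = ⊗-distribˡ-⊕ , comm∧distrˡ⇒distrʳ ⊗-comm ⊗-distribˡ-⊕
        }
      ; *-comm = ⊗-comm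
      }
    }

  -- The ring solver gets integer coefficients, embedded by ι: with 𝒪 as its own coefficient
  -- ring its normal forms would not compute, since trω m and nmω m are stuck on m.
  ι-homomorphism : CommutativeRing.rawRing ℤ.+-*-commutativeRing
                   -Raw-AlmostCommutative⟶ fromCommutativeRing ⊕-⊗-commutativeRing
  ι-homomorphism = record
    { ⟦_⟧    = ι
    ; +-homo = λ _ _ → refl
    ; *-homo = ι-⊗
    ; -‿homo = λ _ → refl
    ; 0-homo = refl
    ; 1-homo = refl
    }

  ι-≟ : ∀ i j → Maybe (ι i ≡ ι j)
  ι-≟ i j with i ℤ.≟ j
  ... | yes i≡j = just (cong ι i≡j)
  ... | no _    = nothing

  open Algebra.Solver.Ring _ _ ι-homomorphism ι-≟ using (solve; _:=_; _:+_; _:-_; _:*_; :-_; con)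

  x⊖y≡𝟘⇒x≡y : ∀ x y → x ⊖ y ≡ 𝟘 → x ≡ y
  x⊖y≡𝟘⇒x≡y x y x⊖y≡𝟘 = begin
    x            ≡⟨ solve 2 (λ x y → x := (x :- y) :+ y) refl x y ⟩
    (x ⊖ y) ⊕ y  ≡⟨ cong (_⊕ y) x⊖y≡𝟘 ⟩
    𝟘 ⊕ y        ≡⟨ ⊕-identityˡ y ⟩
    y            ∎
    where open ≡-Reasoning

  x⊕y≡𝟘⇒x≡⊝y : ∀ x y → x ⊕ y ≡ 𝟘 → x ≡ ⊝ y
  x⊕y≡𝟘⇒x≡⊝y x y x⊕y≡𝟘 = begin
    x            ≡⟨ solve 2 (λ x y → x := (x :+ y) :- y) refl x y ⟩
    (x ⊕ y) ⊖ y  ≡⟨ cong (_⊖ y) x⊕y≡𝟘 ⟩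
    𝟘 ⊖ y        ≡⟨ solve 1 (λ y → con (+ 0) :- y := :- y) refl y ⟩
    ⊝ y          ∎
    where open ≡-Reasoning

  𝟜 : 𝒪
  𝟜 = ι (+ 4)

  -- δ = |disc 𝒪_K| (m or 4m), positive exactly when N is positive definite
  δ : ℤ
  δ = + 4 * nmω m - trω m * trω m

  -- the trace form Tr(x ȳ), i.e. the polarisation of N
  ⟨_,_⟩ : 𝒪 → 𝒪 → ℤ
  ⟨ x₁ + x₂ ω , y₁ + y₂ ω ⟩ = + 2 * (x₁ * y₁) + trω m * (x₁ * y₂ + x₂ * y₁) + + 2 * (nmω m * (x₂ * y₂))

  N-ι : ∀ i → N (ι i) ≡ i * i
  N-ι i = identity (trω m) (nmω m) i
    where
    identity : ∀ T M i → i * i + T * (i * + 0) + M * (+ 0 * + 0) ≡ i * i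
    identity = solve-∀

  N-⊗ : ∀ x y → N (x ⊗ y) ≡ N x * N y
  N-⊗ (x₁ + x₂ ω) (y₁ + y₂ ω) = identity (trω m) (nmω m) x₁ x₂ y₁ y₂
    where
    identity : ∀ T M x₁ x₂ y₁ y₂ →
      let n = λ (x y : ℤ) → x * x + T * (x * y) + M * (y * y) in
      n (x₁ * y₁ - M * (x₂ * y₂)) (x₁ * y₂ + x₂ * y₁ + T * (x₂ * y₂)) ≡ n x₁ x₂ * n y₁ y₂
    identity = solve-∀

  N-ι⊗ : ∀ i x → N (ι i ⊗ x) ≡ i * i * N x
  N-ι⊗ i x = trans (N-⊗ (ι i) x) (cong (_* N x) (N-ι i))

  N-⊕ : ∀ x y → N (x ⊕ y) ≡ N x + N y + ⟨ x , y ⟩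
  N-⊕ (x₁ + x₂ ω) (y₁ + y₂ ω) = identity (trω m) (nmω m) x₁ x₂ y₁ y₂
    where
    identity : ∀ T M x₁ x₂ y₁ y₂ →
      let n = λ (x y : ℤ) → x * x + T * (x * y) + M * (y * y) in
      n (x₁ + y₁) (x₂ + y₂) ≡ n x₁ x₂ + n y₁ y₂
        + (+ 2 * (x₁ * y₁) + T * (x₁ * y₂ + x₂ * y₁) + + 2 * (M * (x₂ * y₂)))
    identity = solve-∀

  N-⊖ : ∀ x y → N (x ⊖ y) ≡ N x + N y - ⟨ x , y ⟩
  N-⊖ (x₁ + x₂ ω) (y₁ + y₂ ω) = identity (trω m) (nmω m) x₁ x₂ y₁ y₂
    where
    identity : ∀ T M x₁ x₂ y₁ y₂ →
      let n = λ (x y : ℤ) → x * x + T * (x * y) + M * (y * y) in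
      n (x₁ - y₁) (x₂ - y₂) ≡ n x₁ x₂ + n y₁ y₂
        - (+ 2 * (x₁ * y₁) + T * (x₁ * y₂ + x₂ * y₁) + + 2 * (M * (x₂ * y₂)))
    identity = solve-∀

  4N≡square+δ*square : ∀ x₁ x₂ →
    + 4 * N (x₁ + x₂ ω) ≡ (+ 2 * x₁ + trω m * x₂) * (+ 2 * x₁ + trω m * x₂) + δ * (x₂ * x₂)
  4N≡square+δ*square x₁ x₂ = identity (trω m) (nmω m) x₁ x₂
    where
    identity : ∀ T M x₁ x₂ →
      + 4 * (x₁ * x₁ + T * (x₁ * x₂) + M * (x₂ * x₂))
      ≡ (+ 2 * x₁ + T * x₂) * (+ 2 * x₁ + T * x₂) + (+ 4 * M - T * T) * (x₂ * x₂)
    identity = solve-∀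

  4NN-⟨⟩²≡δ*square : ∀ x₁ x₂ y₁ y₂ → let x = x₁ + x₂ ω ; y = y₁ + y₂ ω in
    + 4 * (N x * N y) - ⟨ x , y ⟩ * ⟨ x , y ⟩ ≡ δ * ((x₁ * y₂ - x₂ * y₁) * (x₁ * y₂ - x₂ * y₁))
  4NN-⟨⟩²≡δ*square x₁ x₂ y₁ y₂ = identity (trω m) (nmω m) x₁ x₂ y₁ y₂
    where
    identity : ∀ T M x₁ x₂ y₁ y₂ →
      let n = λ (x y : ℤ) → x * x + T * (x * y) + M * (y * y)
          b = + 2 * (x₁ * y₁) + T * (x₁ * y₂ + x₂ * y₁) + + 2 * (M * (x₂ * y₂)) in
      + 4 * (n x₁ x₂ * n y₁ y₂) - b * b ≡ (+ 4 * M - T * T) * ((x₁ * y₂ - x₂ * y₁) * (x₁ * y₂ - x₂ * y₁))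
    identity = solve-∀

  δ-positive : 1 ℕ.≤ m → + 1 ≤ δ
  δ-positive 1≤m with m ℕ.% 4 ℕ.≟ 3
  ... | yes m%4≡3 = 1≤i⇒j≤1⇒1≤4*i-j (+≤+ (ℕ.m≥n⇒m/n>0 (ℕₚ.+-monoˡ-≤ 1 3≤m))) ℤ.≤-refl
    where 3≤m = subst (ℕ._≤ m) m%4≡3 (ℕ.m%n≤m m 4)
  ... | no  _     = 1≤i⇒j≤1⇒1≤4*i-j (+≤+ 1≤m) (+≤+ z≤n)

  module _ (1≤m : 1 ℕ.≤ m) where

    0≤δ : 0ℤ ≤ δ
    0≤δ = ℤ.≤-trans (+≤+ z≤n) (δ-positive 1≤m)

    N-nonNeg : ∀ x → 0ℤ ≤ N x
    N-nonNeg (x₁ + x₂ ω) = ℤ.*-cancelˡ-≤-pos 0ℤ (N (x₁ + x₂ ω)) (+ 4) (begin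
      + 4 * 0ℤ                   ≡⟨⟩
      0ℤ                         ≤⟨ ℤ.+-mono-≤ (0≤i*i (+ 2 * x₁ + trω m * x₂)) (0≤i*j 0≤δ (0≤i*i x₂)) ⟩
      (+ 2 * x₁ + trω m * x₂) * (+ 2 * x₁ + trω m * x₂) + δ * (x₂ * x₂)
                                 ≡⟨ 4N≡square+δ*square x₁ x₂ ⟨
      + 4 * N (x₁ + x₂ ω)        ∎)
      where open ℤ.≤-Reasoning

    N≡0⇒≡𝟘 : ∀ x → N x ≡ 0ℤ → x ≡ 𝟘
    N≡0⇒≡𝟘 (x₁ + x₂ ω) Nx≡0 = cong₂ _+_ω x₁≡0 x₂≡0
      where
      δx₂²≡0 : δ * (x₂ * x₂) ≡ 0ℤ
      δx₂²≡0 = 0≤i⇒0≤j⇒i+j≡0⇒j≡0 (0≤i*i (+ 2 * x₁ + trω m * x₂)) (0≤i*j 0≤δ (0≤i*i x₂))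
        (trans (sym (4N≡square+δ*square x₁ x₂)) (cong (+ 4 *_) Nx≡0))
      x₂≡0 : x₂ ≡ 0ℤ
      x₂≡0 = i*i≡0⇒i≡0 x₂ (1≤i⇒i*j≡0⇒j≡0 (δ-positive 1≤m) δx₂²≡0)
      x₁≡0 : x₁ ≡ 0ℤ
      x₁≡0 = i*i≡0⇒i≡0 x₁ (trans (sym (N-ι x₁)) (trans (cong (λ y → N (x₁ + y ω)) (sym x₂≡0)) Nx≡0))

    cauchy-schwarz : ∀ x y → ⟨ x , y ⟩ * ⟨ x , y ⟩ ≤ + 4 * (N x * N y)
    cauchy-schwarz (x₁ + x₂ ω) (y₁ + y₂ ω) = ℤ.0≤i-j⇒j≤i
      (subst (0ℤ ≤_) (sym (4NN-⟨⟩²≡δ*square x₁ x₂ y₁ y₂)) (0≤i*j 0≤δ (0≤i*i (x₁ * y₂ - x₂ * y₁))))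

    ⟨⟩²-bound : ∀ x y k → N x * N y ≤ k * k → ⟨ x , y ⟩ * ⟨ x , y ⟩ ≤ (+ 2 * k) * (+ 2 * k)
    ⟨⟩²-bound x y k NxNy≤k² = begin
      ⟨ x , y ⟩ * ⟨ x , y ⟩ ≤⟨ cauchy-schwarz x y ⟩
      + 4 * (N x * N y)     ≤⟨ ℤ.*-monoˡ-≤-nonNeg (+ 4) NxNy≤k² ⟩
      + 4 * (k * k)         ≡⟨ identity k ⟩
      (+ 2 * k) * (+ 2 * k) ∎
      where
      open ℤ.≤-Reasoning
      identity : ∀ k → + 4 * (k * k) ≡ (+ 2 * k) * (+ 2 * k)
      identity = solve-∀

    N-⊕-≤ : ∀ x y k → 0ℤ ≤ k → N x * N y ≤ k * k → N (x ⊕ y) ≤ N x + N y + + 2 * k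
    N-⊕-≤ x y k 0≤k NxNy≤k² = begin
      N (x ⊕ y)              ≡⟨ N-⊕ x y ⟩
      N x + N y + ⟨ x , y ⟩  ≤⟨ ℤ.+-monoʳ-≤ (N x + N y) ⟨x,y⟩≤2k ⟩
      N x + N y + + 2 * k    ∎
      where
      open ℤ.≤-Reasoning
      ⟨x,y⟩≤2k : ⟨ x , y ⟩ ≤ + 2 * k
      ⟨x,y⟩≤2k = i*i≤j*j⇒i≤j (0≤i*j {+ 2} (+≤+ z≤n) 0≤k) (⟨⟩²-bound x y k NxNy≤k²)

    N-⊖-≤ : ∀ x y k → 0ℤ ≤ k → N x * N y ≤ k * k → N (x ⊖ y) ≤ N x + N y + + 2 * k
    N-⊖-≤ x y k 0≤k NxNy≤k² = begin
      N (x ⊖ y)              ≡⟨ N-⊖ x y ⟩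
      N x + N y - ⟨ x , y ⟩  ≤⟨ ℤ.+-monoʳ-≤ (N x + N y) -⟨x,y⟩≤2k ⟩
      N x + N y + + 2 * k    ∎
      where
      open ℤ.≤-Reasoning
      square-neg : ∀ i → (- i) * (- i) ≡ i * i
      square-neg = solve-∀
      -⟨x,y⟩≤2k : - ⟨ x , y ⟩ ≤ + 2 * k
      -⟨x,y⟩≤2k = i*i≤j*j⇒i≤j (0≤i*j {+ 2} (+≤+ z≤n) 0≤k)
        (subst (_≤ (+ 2 * k) * (+ 2 * k)) (sym (square-neg ⟨ x , y ⟩)) (⟨⟩²-bound x y k NxNy≤k²))

    x⊗y≡𝟘⇒x≡𝟘∨y≡𝟘 : ∀ x y → x ⊗ y ≡ 𝟘 → x ≡ 𝟘 ⊎ y ≡ 𝟘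
    x⊗y≡𝟘⇒x≡𝟘∨y≡𝟘 x y xy≡𝟘 = Sum.map (N≡0⇒≡𝟘 x) (N≡0⇒≡𝟘 y) (ℤ.i*j≡0⇒i≡0∨j≡0 (N x) {N y} NxNy≡0)
      where
      NxNy≡0 : N x * N y ≡ 0ℤ
      NxNy≡0 = trans (sym (N-⊗ x y)) (trans (cong N xy≡𝟘) (N-ι 0ℤ))

    x⊗x≡y⊗y⇒x≡y∨x≡⊝y : ∀ x y → x ⊗ x ≡ y ⊗ y → x ≡ y ⊎ x ≡ ⊝ y
    x⊗x≡y⊗y⇒x≡y∨x≡⊝y x y x²≡y² =
      Sum.map (x⊖y≡𝟘⇒x≡y x y) (x⊕y≡𝟘⇒x≡⊝y x y) (x⊗y≡𝟘⇒x≡𝟘∨y≡𝟘 (x ⊖ y) (x ⊕ y) [x-y][x+y]≡𝟘)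
      where
      [x-y][x+y]≡𝟘 : (x ⊖ y) ⊗ (x ⊕ y) ≡ 𝟘
      [x-y][x+y]≡𝟘 = begin
        (x ⊖ y) ⊗ (x ⊕ y)  ≡⟨ solve 2 (λ x y → (x :- y) :* (x :+ y) := x :* x :- y :* y) refl x y ⟩
        (x ⊗ x) ⊖ (y ⊗ y)  ≡⟨ cong (_⊖ (y ⊗ y)) x²≡y² ⟩
        (y ⊗ y) ⊖ (y ⊗ y)  ≡⟨ solve 1 (λ u → u :- u := con (+ 0)) refl (y ⊗ y) ⟩
        𝟘                  ∎
        where open ≡-Reasoning

    parallelogram : ∀ x y → N (x ⊕ y) ≡ + 2 * N x + + 2 * N y - N (x ⊖ y)
    parallelogram x y = begin
      N (x ⊕ y)                                   ≡⟨ N-⊕ x y ⟩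
      N x + N y + ⟨ x , y ⟩                       ≡⟨ identity (N x) (N y) ⟨ x , y ⟩ ⟩
      + 2 * N x + + 2 * N y - (N x + N y - ⟨ x , y ⟩) ≡⟨ cong (λ z → + 2 * N x + + 2 * N y - z) (N-⊖ x y) ⟨
      + 2 * N x + + 2 * N y - N (x ⊖ y)           ∎
      where
      open ≡-Reasoning
      identity : ∀ u v b → u + v + b ≡ + 2 * u + + 2 * v - (u + v - b)
      identity = solve-∀

    N[x⊕y]≤[k+1]² : ∀ {k} {{_ : NonZero k}} x y → x ⊗ y ≡ ι (+ k) →
                    N (x ⊕ y) ≤ (+ k + + 1) * (+ k + + 1)
    N[x⊕y]≤[k+1]² {k} x y xy≡k = begin
      N (x ⊕ y)                       ≤⟨ N-⊕-≤ x y (+ k) (+≤+ z≤n) (ℤ.≤-reflexive NxNy≡k²) ⟩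
      N x + N y + + 2 * + k           ≤⟨ ℤ.+-monoˡ-≤ (+ 2 * + k) Nx+Ny≤NxNy+1 ⟩
      N x * N y + + 1 + + 2 * + k     ≡⟨ cong (λ z → z + + 1 + + 2 * + k) NxNy≡k² ⟩
      + k * + k + + 1 + + 2 * + k     ≡⟨ identity (+ k) ⟩
      (+ k + + 1) * (+ k + + 1)       ∎
      where
      open ℤ.≤-Reasoning
      identity : ∀ k → k * k + + 1 + + 2 * k ≡ (k + + 1) * (k + + 1)
      identity = solve-∀
      NxNy≡k² : N x * N y ≡ + k * + k
      NxNy≡k² = trans (sym (N-⊗ x y)) (trans (cong N xy≡k) (N-ι (+ k)))
      k²≢0 : + k * + k ≢ 0ℤ
      k²≢0 k²≡0 = ℕ.≢-nonZero⁻¹ k (ℤ.+-injective (i*i≡0⇒i≡0 (+ k) k²≡0))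
      1≤Nx : + 1 ≤ N x
      1≤Nx = 0≤i⇒i≢0⇒1≤i (N-nonNeg x) λ Nx≡0 → k²≢0 (trans (sym NxNy≡k²) (cong (_* N y) Nx≡0))
      1≤Ny : + 1 ≤ N y
      1≤Ny = 0≤i⇒i≢0⇒1≤i (N-nonNeg y) λ Ny≡0 →
        k²≢0 (trans (sym NxNy≡k²) (trans (cong (N x *_) Ny≡0) (ℤ.*-zeroʳ (N x))))
      Nx+Ny≤NxNy+1 : N x + N y ≤ N x * N y + + 1
      Nx+Ny≤NxNy+1 = subst (_≤ N x * N y + + 1) (ℤ.*-identityˡ (N x + N y))
        (a≤i⇒a≤j⇒a*[i+j]≤i*j+a*a 1≤Nx 1≤Ny)

    t²-3≡s²⇒N[t]≤4 : ∀ s t → s ⊗ s ≡ ((t ⊗ t) ⊖ 𝟜) ⊕ 𝟙 → N t ≤ + 4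
    t²-3≡s²⇒N[t]≤4 s t s²≡t²-3 = ℤ.*-cancelˡ-≤-pos (N t) (+ 4) (+ 4) 4Nt≤16
      where
      [t-s]+[t+s]≡2t : (t ⊖ s) ⊕ (t ⊕ s) ≡ 𝟚 ⊗ t
      [t-s]+[t+s]≡2t = solve 2 (λ t s → (t :- s) :+ (t :+ s) := con (+ 2) :* t) refl t s
      [t-s][t+s]≡3 : (t ⊖ s) ⊗ (t ⊕ s) ≡ ι (+ 3)
      [t-s][t+s]≡3 = begin
        (t ⊖ s) ⊗ (t ⊕ s)              ≡⟨ solve 2 (λ t s → (t :- s) :* (t :+ s) := t :* t :- s :* s) refl t s ⟩
        (t ⊗ t) ⊖ (s ⊗ s)              ≡⟨ cong ((t ⊗ t) ⊖_) s²≡t²-3 ⟩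
        (t ⊗ t) ⊖ (((t ⊗ t) ⊖ 𝟜) ⊕ 𝟙)  ≡⟨ solve 1 (λ u → u :- ((u :- con (+ 4)) :+ con (+ 1)) := con (+ 3)) refl (t ⊗ t) ⟩
        ι (+ 3)                        ∎
        where open ≡-Reasoning
      4Nt≤16 : + 4 * N t ≤ + 4 * + 4
      4Nt≤16 = begin
        + 4 * N t              ≡⟨ N-ι⊗ (+ 2) t ⟨
        N (𝟚 ⊗ t)              ≡⟨ cong N [t-s]+[t+s]≡2t ⟨
        N ((t ⊖ s) ⊕ (t ⊕ s))  ≤⟨ N[x⊕y]≤[k+1]² (t ⊖ s) (t ⊕ s) [t-s][t+s]≡3 ⟩
        + 16                   ∎
        where open ℤ.≤-Reasoning

    N[t]≤4⇒N[t²-4]≤64 : ∀ t → N t ≤ + 4 → N ((t ⊗ t) ⊖ 𝟜) ≤ + 64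
    N[t]≤4⇒N[t²-4]≤64 t Nt≤4 = begin
      N ((t ⊗ t) ⊖ 𝟜)              ≤⟨ N-⊖-≤ (t ⊗ t) 𝟜 (+ 16) (+≤+ z≤n) N[t²]N[4]≤16² ⟩
      N (t ⊗ t) + N 𝟜 + + 32        ≡⟨ cong (λ z → N (t ⊗ t) + z + + 32) (N-ι (+ 4)) ⟩
      N (t ⊗ t) + + 16 + + 32       ≤⟨ ℤ.+-monoˡ-≤ (+ 32) (ℤ.+-monoˡ-≤ (+ 16) N[t²]≤16) ⟩
      + 64                         ∎
      where
      open ℤ.≤-Reasoning
      N[t²]≤16 : N (t ⊗ t) ≤ + 16
      N[t²]≤16 = subst (_≤ + 16) (sym (N-⊗ t t)) (i≤j⇒i*i≤j*j (N-nonNeg t) Nt≤4)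
      N[t²]N[4]≤16² : N (t ⊗ t) * N 𝟜 ≤ + 16 * + 16
      N[t²]N[4]≤16² = subst (λ z → N (t ⊗ t) * z ≤ + 16 * + 16) (sym (N-ι (+ 4)))
        (ℤ.*-monoʳ-≤-nonNeg (+ 16) N[t²]≤16)

    80≤N[c⊗d] : ∀ a b c d → + 4 ≤ N a → N a ≤ N b → N b ≤ N c → N b ≤ N d →
                N (a ⊖ b) ≤ + 4 → c ⊕ d ≡ 𝟚 ⊗ (a ⊕ b) → + 80 ≤ N (c ⊗ d)
    80≤N[c⊗d] a b c d 4≤Na Na≤Nb Nb≤Nc Nb≤Nd N[a-b]≤4 c+d≡2[a+b] = begin
      + 80                                ≡⟨⟩
      + 2 * + 48 - + 16                   ≤⟨ ℤ.+-monoˡ-≤ (- + 16) (ℤ.*-monoˡ-≤-nonNeg (+ 2) 48≤2[Nc+Nd]) ⟩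
      + 2 * (+ 2 * (N c + N d)) - + 16    ≡⟨ cong (_- + 16) (ℤ.*-assoc (+ 2) (+ 2) (N c + N d)) ⟨
      + 4 * (N c + N d) - + 16            ≤⟨ ℤ.+-monoˡ-≤ (- + 16) (a≤i⇒a≤j⇒a*[i+j]≤i*j+a*a 4≤Nc 4≤Nd) ⟩
      N c * N d + + 16 - + 16             ≡⟨ identity (N c * N d) ⟩
      N c * N d                           ≡⟨ N-⊗ c d ⟨
      N (c ⊗ d)                           ∎
      where
      open ℤ.≤-Reasoning
      identity : ∀ i → i + + 16 - + 16 ≡ i
      identity = solve-∀
      4≤Nb : + 4 ≤ N b
      4≤Nb = ℤ.≤-trans 4≤Na Na≤Nb
      4≤Nc : + 4 ≤ N c
      4≤Nc = ℤ.≤-trans 4≤Nb Nb≤Nc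
      4≤Nd : + 4 ≤ N d
      4≤Nd = ℤ.≤-trans 4≤Nb Nb≤Nd
      48≤2[Nc+Nd] : + 48 ≤ + 2 * (N c + N d)
      48≤2[Nc+Nd] = begin
        + 48                                       ≡⟨⟩
        + 4 * (+ 2 * + 4 + + 2 * + 4 - + 4)        ≤⟨ ℤ.*-monoˡ-≤-nonNeg (+ 4) 12≤2Na+2Nb-N[a-b] ⟩
        + 4 * (+ 2 * N a + + 2 * N b - N (a ⊖ b))  ≡⟨ cong (+ 4 *_) (parallelogram a b) ⟨
        + 4 * N (a ⊕ b)                            ≡⟨ N-ι⊗ (+ 2) (a ⊕ b) ⟨
        N (𝟚 ⊗ (a ⊕ b))                            ≡⟨ cong N c+d≡2[a+b] ⟨
        N (c ⊕ d)                                  ≡⟨ parallelogram c d ⟩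
        + 2 * N c + + 2 * N d - N (c ⊖ d)          ≤⟨ ℤ.i-j≤i _ (N (c ⊖ d)) {{ℤ.nonNegative (N-nonNeg (c ⊖ d))}} ⟩
        + 2 * N c + + 2 * N d                      ≡⟨ ℤ.*-distribˡ-+ (+ 2) (N c) (N d) ⟨
        + 2 * (N c + N d)                          ∎
        where
        12≤2Na+2Nb-N[a-b] : + 2 * + 4 + + 2 * + 4 - + 4 ≤ + 2 * N a + + 2 * N b - N (a ⊖ b)
        12≤2Na+2Nb-N[a-b] = ℤ.+-mono-≤
          (ℤ.+-mono-≤ (ℤ.*-monoˡ-≤-nonNeg (+ 2) 4≤Na) (ℤ.*-monoˡ-≤-nonNeg (+ 2) 4≤Nb))
          (ℤ.neg-mono-≤ N[a-b]≤4)

  Extension : 𝒪 → 𝒪 → 𝒪 → 𝒪 → Set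
  Extension a b r c = (c ≡ (a ⊕ b) ⊕ (𝟚 ⊗ r)) ⊎ (c ≡ (a ⊕ b) ⊖ (𝟚 ⊗ r))

  Extension-⊝ : ∀ a b r c → Extension a b (⊝ r) c → Extension a b r c
  Extension-⊝ a b r c (inj₁ c≡) =
    inj₂ (trans c≡ (solve 3 (λ a b r → (a :+ b) :+ (con (+ 2) :* (:- r)) := (a :+ b) :- (con (+ 2) :* r)) refl a b r))
  Extension-⊝ a b r c (inj₂ c≡) =
    inj₁ (trans c≡ (solve 3 (λ a b r → (a :+ b) :- (con (+ 2) :* (:- r)) := (a :+ b) :+ (con (+ 2) :* r)) refl a b r))

  extension-product : ∀ a b r → r ⊗ r ≡ (a ⊗ b) ⊕ 𝟙 →
    ((a ⊕ b) ⊕ (𝟚 ⊗ r)) ⊗ ((a ⊕ b) ⊖ (𝟚 ⊗ r)) ≡ ((a ⊖ b) ⊗ (a ⊖ b)) ⊖ 𝟜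
  extension-product a b r r²≡ab+1 = begin
    ((a ⊕ b) ⊕ (𝟚 ⊗ r)) ⊗ ((a ⊕ b) ⊖ (𝟚 ⊗ r))
      ≡⟨ solve 3 (λ a b r → ((a :+ b) :+ (con (+ 2) :* r)) :* ((a :+ b) :- (con (+ 2) :* r))
                             := (a :+ b) :* (a :+ b) :- con (+ 4) :* (r :* r)) refl a b r ⟩
    ((a ⊕ b) ⊗ (a ⊕ b)) ⊖ (𝟜 ⊗ (r ⊗ r))
      ≡⟨ cong (λ z → ((a ⊕ b) ⊗ (a ⊕ b)) ⊖ (𝟜 ⊗ z)) r²≡ab+1 ⟩
    ((a ⊕ b) ⊗ (a ⊕ b)) ⊖ (𝟜 ⊗ ((a ⊗ b) ⊕ 𝟙))
      ≡⟨ solve 2 (λ a b → (a :+ b) :* (a :+ b) :- con (+ 4) :* (a :* b :+ con (+ 1))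
                           := (a :- b) :* (a :- b) :- con (+ 4)) refl a b ⟩
    ((a ⊖ b) ⊗ (a ⊖ b)) ⊖ 𝟜
      ∎
    where open ≡-Reasoning

  extension-sum : ∀ a b r → ((a ⊕ b) ⊕ (𝟚 ⊗ r)) ⊕ ((a ⊕ b) ⊖ (𝟚 ⊗ r)) ≡ 𝟚 ⊗ (a ⊕ b)
  extension-sum = solve 3 (λ a b r → ((a :+ b) :+ (con (+ 2) :* r)) :+ ((a :+ b) :- (con (+ 2) :* r))
                                      := con (+ 2) :* (a :+ b)) refl

  distinct-extensions : ∀ a b r c d → r ⊗ r ≡ (a ⊗ b) ⊕ 𝟙 →
    Extension a b r c → Extension a b r d → c ≢ d →
    (c ⊗ d ≡ ((a ⊖ b) ⊗ (a ⊖ b)) ⊖ 𝟜) × (c ⊕ d ≡ 𝟚 ⊗ (a ⊕ b))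
  distinct-extensions a b r c d r² (inj₁ refl) (inj₁ refl) c≢d = contradiction refl c≢d
  distinct-extensions a b r c d r² (inj₂ refl) (inj₂ refl) c≢d = contradiction refl c≢d
  distinct-extensions a b r c d r² (inj₁ refl) (inj₂ refl) _ = extension-product a b r r² , extension-sum a b r
  distinct-extensions a b r c d r² (inj₂ refl) (inj₁ refl) _ =
    trans (⊗-comm c d) (extension-product a b r r²) , trans (⊕-comm c d) (extension-sum a b r)

  regular-pair : 1 ℕ.≤ m → ∀ a b c d → Regular a b c → Regular a b d → c ≢ d →
    (c ⊗ d ≡ ((a ⊖ b) ⊗ (a ⊖ b)) ⊖ 𝟜) × (c ⊕ d ≡ 𝟚 ⊗ (a ⊕ b))
  regular-pair 1≤m a b c d (r , r² , c-ext) (q , q² , d-ext) c≢d =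
    distinct-extensions a b r c d r² c-ext (Extension-±r (x⊗x≡y⊗y⇒x≡y∨x≡⊝y 1≤m q r (trans q² (sym r²)))) c≢d
    where
    Extension-±r : q ≡ r ⊎ q ≡ ⊝ r → Extension a b r d
    Extension-±r (inj₁ refl) = d-ext
    Extension-±r (inj₂ refl) = Extension-⊝ a b r d d-ext

open import Data.Nat using (_≤_)
open import Data.Integer using (+_) renaming (_≤_ to _≤ℤ_)
open import Data.Integer.Properties using (_≤?_; ≤-trans)
open import Data.Product using (_×_; _,_; proj₁; proj₂)
open import Relation.Nullary using (¬_)
open import Relation.Nullary.Decidable using (from-no)
open import Relation.Binary.PropositionalEquality using (_≡_; cong; sym; trans; subst)

lemma6 : (m : ℕ) → 1 ≤ m → SquareFree m →
    let open OK m in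
    (a b c d : 𝒪) → DiophantineQuadruple a b c d →
    (+ 4) ≤ℤ N a → a ≤∣∣ b → b ≤∣∣ c → c ≤∣∣ d →
    ¬ (Regular a b c × Regular a b d)
lemma6 m 1≤m _ a b c d ((_ , _ , _ , _ , _ , c≢d) , (_ , _ , _ , _ , _ , s , s²≡cd+1))
       4≤Na Na≤Nb Nb≤Nc Nc≤Nd (regular-c , regular-d) =
  from-no (+ 80 ≤? + 64) (≤-trans 80≤N[cd] N[cd]≤64)
  where
  open OK m
  open QuadraticOrder m
  cd≡[a-b]²-4 : c ⊗ d ≡ ((a ⊖ b) ⊗ (a ⊖ b)) ⊖ 𝟜
  cd≡[a-b]²-4 = proj₁ (regular-pair 1≤m a b c d regular-c regular-d c≢d)
  c+d≡2[a+b] : c ⊕ d ≡ 𝟚 ⊗ (a ⊕ b)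
  c+d≡2[a+b] = proj₂ (regular-pair 1≤m a b c d regular-c regular-d c≢d)
  N[a-b]≤4 : N (a ⊖ b) ≤ℤ + 4
  N[a-b]≤4 = t²-3≡s²⇒N[t]≤4 1≤m s (a ⊖ b) (trans s²≡cd+1 (cong (_⊕ 𝟙) cd≡[a-b]²-4))
  N[cd]≤64 : N (c ⊗ d) ≤ℤ + 64
  N[cd]≤64 = subst (_≤ℤ + 64) (cong N (sym cd≡[a-b]²-4)) (N[t]≤4⇒N[t²-4]≤64 1≤m (a ⊖ b) N[a-b]≤4)
  80≤N[cd] : + 80 ≤ℤ N (c ⊗ d)
  80≤N[cd] = 80≤N[c⊗d] 1≤m a b c d 4≤Na Na≤Nb Nb≤Nc (≤-trans Nb≤Nc Nc≤Nd) N[a-b]≤4 c+d≡2[a+b]
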